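{- Let $G$ be a connected graph with $n$ vertices and $m$ edges. Then $$BH(G)\geq \frac{16nm^4}{[2m+M_1(G)]^3}$$ with equality if and only if $G\cong K_n$.
   Context: For a graph $G$ on $n$ vertices, $L(G)=D(G)-A(G)$ is its Laplacian matrix with eigenvalues $0=\lambda_1\le\lambda_2\le\cdots\le\lambda_n$. The biharmonic index is $BH(G)=\frac12\sum_{u,v\in V(G)}d_B^2(u,v)$ with $d_B^2$ the squared biharmonic distance; equivalently $BH(G)=n\sum_{i=2}^n\lambda_i^{ -2}$. $M_1(G)=\sum_{v}d(v)^2$ is the first Zagreb index ($d(v)$ the degree). $K_n$ is the complete graph. -}

module Defs where

open import Data.Nat as ℕ using (ℕ; zero; suc; _<ᵇ_)
open import Data.Fin using (Fin; zero; suc; toℕ; _≟_)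
open import Data.Bool using (Bool; true; false; if_then_else_)
open import Data.Integer using (+_)
open import Data.Rational using (ℚ; 0ℚ; 1ℚ; ½; _+_; _*_; _-_; -_; _/_)
open import Data.Product using (Σ; _×_)
open import Relation.Binary.PropositionalEquality using (_≡_; _≢_)
open import Relation.Nullary.Decidable using (does)
open import Function using (_∘_)
open import Function.Bundles using (_↔_; Inverse)

record Graph (n : ℕ) : Set where
  field
    adj   : Fin n → Fin n → Bool
    adj-sym : ∀ u v → adj u v ≡ adj v u
    adj-irrefl : ∀ u → adj u u ≡ false
open Graph public

sumℕ : ∀ {n} → (Fin n → ℕ) → ℕ
sumℕ {zero}  f = 0
sumℕ {suc n} f = f zero ℕ.+ sumℕ (f ∘ suc)

sumℚ : ∀ {n} → (Fin n → ℚ) → ℚ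
sumℚ {zero}  f = 0ℚ
sumℚ {suc n} f = f zero + sumℚ (f ∘ suc)

toℚ : ℕ → ℚ
toℚ k = + k / 1

b2ℕ : Bool → ℕ
b2ℕ true  = 1
b2ℕ false = 0

deg : ∀ {n} → Graph n → Fin n → ℕ
deg G u = sumℕ λ v → b2ℕ (adj G u v)

edges : ∀ {n} → Graph n → ℕ
edges G = sumℕ λ u → sumℕ λ v → b2ℕ (if toℕ u <ᵇ toℕ v then adj G u v else false)

M₁ : ∀ {n} → Graph n → ℕ
M₁ G = sumℕ λ v → deg G v ℕ.* deg G v

data Walk {n} (G : Graph n) : Fin n → Fin n → Set where
  here : ∀ {u} → Walk G u u
  step : ∀ {u v w} → adj G u v ≡ true → Walk G v w → Walk G u w

Connected : ∀ {n} → Graph n → Set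
Connected G = ∀ u v → Walk G u v

K : (n : ℕ) → Graph n
K n = record
  { adj = λ u v → if does (u ≟ v) then false else true
  ; adj-sym = symK ; adj-irrefl = irrK }
  where
  open import Relation.Nullary using (yes; no)
  open import Relation.Binary.PropositionalEquality using (refl; sym)
  symK : ∀ (u v : Fin n) → (if does (u ≟ v) then false else true) ≡ (if does (v ≟ u) then false else true)
  symK u v with u ≟ v | v ≟ u
  ... | yes _ | yes _ = refl
  ... | no _  | no _  = refl
  ... | yes p | no q  = Data.Empty.⊥-elim (q (sym p)) where import Data.Empty
  ... | no p  | yes q = Data.Empty.⊥-elim (p (sym q)) where import Data.Empty
  irrK : ∀ (u : Fin n) → (if does (u ≟ u) then false else true) ≡ false
  irrK u with u ≟ u
  ... | yes _ = refl
  ... | no ¬p = Data.Empty.⊥-elim (¬p refl) where import Data.Empty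

_≅_ : ∀ {n} → Graph n → Graph n → Set
_≅_ {n} G H = Σ (Fin n ↔ Fin n) λ f →
  ∀ u v → adj G u v ≡ adj H (Inverse.to f u) (Inverse.to f v)

Matrix : ℕ → Set
Matrix n = Fin n → Fin n → ℚ

_⊗_ : ∀ {n} → Matrix n → Matrix n → Matrix n
(A ⊗ B) i j = sumℚ λ k → A i k * B k j

transpose : ∀ {n} → Matrix n → Matrix n
transpose A i j = A j i

laplacian : ∀ {n} → Graph n → Matrix n
laplacian G u v = if does (u ≟ v) then toℚ (deg G u)
                  else (if adj G u v then - 1ℚ else 0ℚ)

IsPseudoInverse : ∀ {n} → Matrix n → Matrix n → Set
IsPseudoInverse A X =
  (∀ i j → (A ⊗ (X ⊗ A)) i j ≡ A i j) ×
  (∀ i j → (X ⊗ (A ⊗ X)) i j ≡ X i j) ×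
  (∀ i j → transpose (A ⊗ X) i j ≡ (A ⊗ X) i j) ×
  (∀ i j → transpose (X ⊗ A) i j ≡ (X ⊗ A) i j)

-- squared biharmonic distance, given the pseudoinverse X = L⁺ of L(G):
-- d_B²(u,v) = (e_u - e_v)ᵀ (L⁺)² (e_u - e_v)
biharmonicSq : ∀ {n} → Matrix n → Fin n → Fin n → ℚ
biharmonicSq X u v = let X² = X ⊗ X in X² u u + X² v v - X² u v - X² v u

BH : ∀ {n} → Matrix n → ℚ
BH {n} X = ½ * sumℚ λ u → sumℚ λ v → biharmonicSq X u v

-- Write L for the Laplacian, X = L⁺, P = LX (the orthogonal projection onto the range of L) and
-- ⟨A, B⟩ = Σᵢⱼ Aᵢⱼ Bᵢⱼ. As X is symmetric with zero row sums, BH(G) = n⟨X, X⟩; moreover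
-- tr L = ⟨P, L⟩ = 2m, ⟨L, L⟩ = 2m + M₁ and ⟨P, P⟩ = ⟨X, L⟩ = tr P. Cauchy–Schwarz for (P, L)
-- and for (X, L) gives (2m)² ≤ tr P ⟨L, L⟩ and (tr P)² ≤ ⟨X, X⟩⟨L, L⟩, hence
-- (2m)⁴ ≤ ⟨X, X⟩⟨L, L⟩³, which is the bound. Equality forces P = μL, so L = PL = μL²; then no
-- path u – w – v has non-adjacent ends, since (L²)ᵤᵥ ≥ 1 while Lᵤᵥ = 0, and a connected graph
-- without such paths is complete. Conversely, for Kₙ one has L² = nL, so X = L/n² and both
-- Cauchy–Schwarz steps are equalities.

module Submission where

open import Defs
open import Data.Nat using (ℕ; NonZero)
open import Data.Rational using (_*_; _≤_)
open import Data.Product using (_×_)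
open import Function.Bundles using (_⇔_)
open import Relation.Binary.PropositionalEquality using (_≡_)

open import Level using (0ℓ)
import Data.Nat as ℕ
import Data.Nat.Properties as ℕ
import Data.Integer as ℤ
import Data.Integer.Properties as ℤ
open import Data.Rational as ℚ using (ℚ; 0ℚ; 1ℚ; ½; _+_; _-_; -_; 1/_)
import Data.Rational.Properties as ℚ
open import Data.Fin as Fin using (Fin; zero; suc; toℕ)
import Data.Fin.Properties as Fin
open import Data.Bool using (Bool; true; false; if_then_else_; T)
open import Data.Unit using (tt)
open import Data.Empty using (⊥-elim)
open import Data.Sum using (_⊎_; inj₁; inj₂; fromInj₂)
open import Data.Product using (_,_; proj₁; proj₂)
open import Data.Nat.Coprimality using (1-coprimeTo) renaming (sym to coprime-sym)
open import Relation.Binary.PropositionalEquality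
  using (refl; sym; trans; cong; cong₂; subst; subst₂; _≢_; module ≡-Reasoning)
open import Relation.Binary.Bundles using (Setoid)
import Relation.Binary.Reasoning.Setoid as SetoidReasoning
open import Relation.Nullary using (¬_; yes; no; Dec)
open import Relation.Nullary.Decidable using (does; dec⇒maybe; dec-true; dec-false)
open import Data.Bool.Properties using (if-float)
open import Function using (_∘_)
open import Function.Bundles using (Inverse; Injection; mk⇔)
open import Function.Properties.Inverse using (Inverse⇒Injection)
open import Function.Construct.Identity using (↔-id)
open import Algebra.Bundles using (CommutativeRing)
import Algebra.Properties.Group as GroupProperties
import Algebra.Properties.Ring as RingProperties
import Algebra.Properties.Semiring.Sum as SemiringSum
open import Tactic.RingSolver using (solve-∀)
open import Tactic.RingSolver.Core.AlmostCommutativeRing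
  using (AlmostCommutativeRing; fromCommutativeRing)
import Data.Nat.Tactic.RingSolver as ℕ-Solver

ℚ-ring : AlmostCommutativeRing 0ℓ 0ℓ
ℚ-ring = fromCommutativeRing ℚ.+-*-commutativeRing (λ x → dec⇒maybe (0ℚ ℚ.≟ x))

open GroupProperties ℚ.+-0-group using (x∙y⁻¹≈ε⇒x≈y; x≈y⇒x∙y⁻¹≈ε)
open RingProperties ℚ.+-*-ring using (x[y-z]≈xy-xz)

toℚ≡mkℚ : ∀ k → toℚ k ≡ ℚ.mkℚ (ℤ.+ k) 0 (coprime-sym (1-coprimeTo k))
toℚ≡mkℚ k = ℚ.normalize-coprime (coprime-sym (1-coprimeTo k))

toℚ-+ : ∀ a b → toℚ a + toℚ b ≡ toℚ (a ℕ.+ b)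
toℚ-+ a b rewrite toℚ≡mkℚ a | toℚ≡mkℚ b =
  cong (ℚ._/ 1) (trans (cong₂ ℤ._+_ (ℤ.+◃n≡+n (a ℕ.* 1)) (ℤ.+◃n≡+n (b ℕ.* 1)))
                        (cong ℤ.+_ (cong₂ ℕ._+_ (ℕ.*-identityʳ a) (ℕ.*-identityʳ b))))

toℚ-* : ∀ a b → toℚ a * toℚ b ≡ toℚ (a ℕ.* b)
toℚ-* a b rewrite toℚ≡mkℚ a | toℚ≡mkℚ b = cong (ℚ._/ 1) (sym (ℤ.pos-* a b))

toℚ-nonNeg : ∀ k → 0ℚ ≤ toℚ k
toℚ-nonNeg k rewrite toℚ≡mkℚ k = ℚ.nonNegative⁻¹ _

toℚ-nonZero : ∀ n → .{{NonZero n}} → toℚ n ≢ 0ℚ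
toℚ-nonZero (ℕ.suc k) eq with trans (sym (toℚ≡mkℚ (ℕ.suc k))) eq
... | ()

-1≢0 : - 1ℚ ≢ 0ℚ
-1≢0 eq = toℚ-nonZero 1 (cong -_ eq)

1≰0 : ¬ (1ℚ ≤ 0ℚ)
1≰0 1≤0 = toℚ-nonZero 1 (ℚ.≤-antisym 1≤0 (toℚ-nonNeg 1))

x*x-mono-≤ : ∀ {x y} → 0ℚ ≤ x → x ≤ y → x * x ≤ y * y
x*x-mono-≤ {x} {y} 0≤x x≤y = ℚ.≤-trans
  (ℚ.*-monoˡ-≤-nonNeg x {{ℚ.nonNegative 0≤x}} x≤y)
  (ℚ.*-monoʳ-≤-nonNeg y {{ℚ.nonNegative (ℚ.≤-trans 0≤x x≤y)}} x≤y)

x*x-nonNeg : ∀ x → 0ℚ ≤ x * x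
x*x-nonNeg x with ℚ.≤-total 0ℚ x
... | inj₁ 0≤x = x*x-mono-≤ ℚ.≤-refl 0≤x
... | inj₂ x≤0 = subst (0ℚ ≤_) (-x*-x≡x*x x) (x*x-mono-≤ ℚ.≤-refl (ℚ.neg-antimono-≤ x≤0))
  where
  -x*-x≡x*x : ∀ x → (- x) * (- x) ≡ x * x
  -x*-x≡x*x = solve-∀ ℚ-ring

x*y≡0⇒x≡0∨y≡0 : ∀ x y → x * y ≡ 0ℚ → x ≡ 0ℚ ⊎ y ≡ 0ℚ
x*y≡0⇒x≡0∨y≡0 x y xy≡0 with x ℚ.≟ 0ℚ
... | yes x≡0 = inj₁ x≡0
... | no x≢0 = inj₂ (begin
  y                   ≡⟨ ℚ.*-identityˡ y ⟨
  1ℚ * y              ≡⟨ cong (_* y) (ℚ.*-inverseˡ x) ⟨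
  (1/ x) * x * y      ≡⟨ ℚ.*-assoc (1/ x) x y ⟩
  (1/ x) * (x * y)    ≡⟨ cong ((1/ x) *_) xy≡0 ⟩
  (1/ x) * 0ℚ         ≡⟨ ℚ.*-zeroʳ (1/ x) ⟩
  0ℚ                  ∎)
  where
  open ≡-Reasoning
  instance _ = ℚ.≢-nonZero x≢0

x*x≡0⇒x≡0 : ∀ x → x * x ≡ 0ℚ → x ≡ 0ℚ
x*x≡0⇒x≡0 x xx≡0 with x*y≡0⇒x≡0∨y≡0 x x xx≡0
... | inj₁ x≡0 = x≡0
... | inj₂ x≡0 = x≡0

difference-of-squares : ∀ x y → (x - y) * (x + y) ≡ x * x - y * y
difference-of-squares = solve-∀ ℚ-ring

*-cancelˡ-≡ : ∀ z {x y} → z ≢ 0ℚ → z * x ≡ z * y → x ≡ y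
*-cancelˡ-≡ z {x} {y} z≢0 zx≡zy with x*y≡0⇒x≡0∨y≡0 z (x - y) z[x-y]≡0
  where
  z[x-y]≡0 : z * (x - y) ≡ 0ℚ
  z[x-y]≡0 = trans (x[y-z]≈xy-xz z x y) (x≈y⇒x∙y⁻¹≈ε zx≡zy)
... | inj₁ z≡0   = ⊥-elim (z≢0 z≡0)
... | inj₂ x-y≡0 = x∙y⁻¹≈ε⇒x≈y x y x-y≡0

0≤x-y⇒y≤x : ∀ x y → 0ℚ ≤ x - y → y ≤ x
0≤x-y⇒y≤x x y 0≤x-y =
  subst₂ _≤_ (ℚ.+-identityʳ y) (y+[x-y]≡x x y) (ℚ.+-monoʳ-≤ y 0≤x-y)
  where
  y+[x-y]≡x : ∀ x y → y + (x - y) ≡ x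
  y+[x-y]≡x = solve-∀ ℚ-ring

0≤x+x⇒0≤x : ∀ x → 0ℚ ≤ x + x → 0ℚ ≤ x
0≤x+x⇒0≤x x 0≤x+x with 0ℚ ℚ.≤? x
... | yes 0≤x = 0≤x
... | no 0≰x = ⊥-elim (ℚ.<-irrefl refl (ℚ.≤-<-trans 0≤x+x (ℚ.+-mono-< x<0 x<0)))
  where
  x<0 : x ℚ.< 0ℚ
  x<0 = ℚ.≰⇒> 0≰x

x+y≡0⇒x≡0 : ∀ {x y} → 0ℚ ≤ x → 0ℚ ≤ y → x + y ≡ 0ℚ → x ≡ 0ℚ
x+y≡0⇒x≡0 {x} {y} 0≤x 0≤y x+y≡0 = ℚ.≤-antisym (subst (x ≤_) x+y≡0 x≤x+y) 0≤x
  where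
  x≤x+y : x ≤ x + y
  x≤x+y = subst (_≤ x + y) (ℚ.+-identityʳ x) (ℚ.+-monoʳ-≤ x 0≤y)

x*x≡y*y⇒x≡y : ∀ {x y} → 0ℚ ≤ x → 0ℚ ≤ y → x * x ≡ y * y → x ≡ y
x*x≡y*y⇒x≡y {x} {y} 0≤x 0≤y xx≡yy with x*y≡0⇒x≡0∨y≡0 (x - y) (x + y) [x-y][x+y]≡0
  where
  [x-y][x+y]≡0 : (x - y) * (x + y) ≡ 0ℚ
  [x-y][x+y]≡0 = trans (difference-of-squares x y) (x≈y⇒x∙y⁻¹≈ε xx≡yy)
... | inj₁ x-y≡0 = x∙y⁻¹≈ε⇒x≈y x y x-y≡0
... | inj₂ x+y≡0 = trans (x+y≡0⇒x≡0 0≤x 0≤y x+y≡0)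
                         (sym (x+y≡0⇒x≡0 0≤y 0≤x (trans (ℚ.+-comm y x) x+y≡0)))

module ℚΣ = SemiringSum (CommutativeRing.semiring ℚ.+-*-commutativeRing)
module ℕΣ = SemiringSum ℕ.+-*-semiring

sumℚ≡sum : ∀ {n} (f : Fin n → ℚ) → sumℚ f ≡ ℚΣ.sum f
sumℚ≡sum {ℕ.zero}  f = refl
sumℚ≡sum {ℕ.suc n} f = cong (f zero +_) (sumℚ≡sum (f ∘ suc))

sumℕ≡sum : ∀ {n} (f : Fin n → ℕ) → sumℕ f ≡ ℕΣ.sum f
sumℕ≡sum {ℕ.zero}  f = refl
sumℕ≡sum {ℕ.suc n} f = cong (f zero ℕ.+_) (sumℕ≡sum (f ∘ suc))

sum-cong : ∀ {n} {f g : Fin n → ℚ} → (∀ i → f i ≡ g i) → sumℚ f ≡ sumℚ g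
sum-cong {ℕ.zero}  f≗g = refl
sum-cong {ℕ.suc n} f≗g = cong₂ _+_ (f≗g zero) (sum-cong (f≗g ∘ suc))

module _ {n : ℕ} where

  sum-distrib-+ : (f g : Fin n → ℚ) → sumℚ (λ i → f i + g i) ≡ sumℚ f + sumℚ g
  sum-distrib-+ f g = trans (sumℚ≡sum (λ i → f i + g i))
    (trans (ℚΣ.∑-distrib-+ f g) (sym (cong₂ _+_ (sumℚ≡sum f) (sumℚ≡sum g))))

  *-distribˡ-sum : (c : ℚ) (f : Fin n → ℚ) → c * sumℚ f ≡ sumℚ (λ i → c * f i)
  *-distribˡ-sum c f = trans (cong (c *_) (sumℚ≡sum f))
    (trans (ℚΣ.*-distribˡ-sum c f) (sym (sumℚ≡sum (λ i → c * f i))))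

  *-distribʳ-sum : (c : ℚ) (f : Fin n → ℚ) → sumℚ f * c ≡ sumℚ (λ i → f i * c)
  *-distribʳ-sum c f = trans (cong (_* c) (sumℚ≡sum f))
    (trans (ℚΣ.*-distribʳ-sum c f) (sym (sumℚ≡sum (λ i → f i * c))))

  sum-comm : ∀ {m} (f : Fin n → Fin m → ℚ) →
    sumℚ (λ i → sumℚ (f i)) ≡ sumℚ (λ j → sumℚ (λ i → f i j))
  sum-comm f = trans (sumℚ²≡sum² f) (trans (ℚΣ.∑-comm f) (sym (sumℚ²≡sum² (λ j i → f i j))))
    where
    sumℚ²≡sum² : ∀ {k l} (g : Fin k → Fin l → ℚ) →
      sumℚ (λ i → sumℚ (g i)) ≡ ℚΣ.sum (λ i → ℚΣ.sum (g i))
    sumℚ²≡sum² g = trans (sumℚ≡sum (λ i → sumℚ (g i))) (ℚΣ.sum-cong-≗ (λ i → sumℚ≡sum (g i)))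

sum-neg : ∀ {n} (f : Fin n → ℚ) → sumℚ (λ i → - f i) ≡ - sumℚ f
sum-neg {ℕ.zero}  f = refl
sum-neg {ℕ.suc n} f = trans (cong (- f zero +_) (sum-neg (f ∘ suc))) (sym (ℚ.neg-distrib-+ (f zero) _))

sum-zero : ∀ {n} {f : Fin n → ℚ} → (∀ i → f i ≡ 0ℚ) → sumℚ f ≡ 0ℚ
sum-zero {ℕ.zero}  f≡0 = refl
sum-zero {ℕ.suc n} f≡0 = trans (cong₂ _+_ (f≡0 zero) (sum-zero (f≡0 ∘ suc))) (ℚ.+-identityˡ 0ℚ)

sum-const : ∀ {n} (c : ℚ) → sumℚ {n} (λ _ → c) ≡ toℚ n * c
sum-const {ℕ.zero}  c = sym (ℚ.*-zeroˡ c)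
sum-const {ℕ.suc n} c = begin
  c + sumℚ {n} (λ _ → c)  ≡⟨ cong (c +_) (sum-const {n} c) ⟩
  c + toℚ n * c           ≡⟨ c+nc≡[1+n]c c (toℚ n) ⟩
  (1ℚ + toℚ n) * c        ≡⟨ cong (_* c) (toℚ-+ 1 n) ⟩
  toℚ (ℕ.suc n) * c       ∎
  where
  open ≡-Reasoning
  c+nc≡[1+n]c : ∀ c n → c + n * c ≡ (1ℚ + n) * c
  c+nc≡[1+n]c = solve-∀ ℚ-ring

sum-override : ∀ {n} (i : Fin n) (x g : Fin n → ℚ) → g i ≡ 0ℚ →
  sumℚ (λ j → if does (i Fin.≟ j) then x j else g j) ≡ x i + sumℚ g
sum-override zero    x g g0≡0 =
  cong (x zero +_) (trans (sym (ℚ.+-identityˡ _)) (cong (_+ sumℚ (g ∘ suc)) (sym g0≡0)))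
sum-override (suc i) x g gi≡0 = begin
  g zero + sumℚ (λ j → if does (i Fin.≟ j) then x (suc j) else g (suc j))
    ≡⟨ cong (g zero +_) (sum-override i (x ∘ suc) (g ∘ suc) gi≡0) ⟩
  g zero + (x (suc i) + sumℚ (g ∘ suc))  ≡⟨ a+[b+c]≡b+[a+c] (g zero) (x (suc i)) _ ⟩
  x (suc i) + (g zero + sumℚ (g ∘ suc))  ∎
  where
  open ≡-Reasoning
  a+[b+c]≡b+[a+c] : ∀ a b c → a + (b + c) ≡ b + (a + c)
  a+[b+c]≡b+[a+c] = solve-∀ ℚ-ring

sum-nonNeg : ∀ {n} {f : Fin n → ℚ} → (∀ i → 0ℚ ≤ f i) → 0ℚ ≤ sumℚ f
sum-nonNeg {ℕ.zero}  0≤f = ℚ.≤-refl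
sum-nonNeg {ℕ.suc n} 0≤f = ℚ.+-mono-≤ (0≤f zero) (sum-nonNeg (0≤f ∘ suc))

term≤sum : ∀ {n} {f : Fin n → ℚ} → (∀ i → 0ℚ ≤ f i) → ∀ i → f i ≤ sumℚ f
term≤sum {f = f} 0≤f zero =
  subst (_≤ sumℚ f) (ℚ.+-identityʳ (f zero)) (ℚ.+-monoʳ-≤ (f zero) (sum-nonNeg (0≤f ∘ suc)))
term≤sum {f = f} 0≤f (suc i) =
  subst (_≤ sumℚ f) (ℚ.+-identityˡ (f (suc i))) (ℚ.+-mono-≤ (0≤f zero) (term≤sum (0≤f ∘ suc) i))

sum≡0⇒term≡0 : ∀ {n} {f : Fin n → ℚ} → (∀ i → 0ℚ ≤ f i) → sumℚ f ≡ 0ℚ → ∀ i → f i ≡ 0ℚ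
sum≡0⇒term≡0 {f = f} 0≤f sum≡0 i = ℚ.≤-antisym (subst (f i ≤_) sum≡0 (term≤sum 0≤f i)) (0≤f i)

sumℕ-cong : ∀ {n} {f g : Fin n → ℕ} → (∀ i → f i ≡ g i) → sumℕ f ≡ sumℕ g
sumℕ-cong {ℕ.zero}  f≗g = refl
sumℕ-cong {ℕ.suc n} f≗g = cong₂ ℕ._+_ (f≗g zero) (sumℕ-cong (f≗g ∘ suc))

toℚ-sum : ∀ {n} (f : Fin n → ℕ) → toℚ (sumℕ f) ≡ sumℚ (toℚ ∘ f)
toℚ-sum {ℕ.zero}  f = refl
toℚ-sum {ℕ.suc n} f = trans (sym (toℚ-+ (f zero) _)) (cong (toℚ (f zero) +_) (toℚ-sum (f ∘ suc)))

module _ {n : ℕ} where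

  sumℕ-distrib-+ : (f g : Fin n → ℕ) → sumℕ (λ i → f i ℕ.+ g i) ≡ sumℕ f ℕ.+ sumℕ g
  sumℕ-distrib-+ f g = trans (sumℕ≡sum (λ i → f i ℕ.+ g i))
    (trans (ℕΣ.∑-distrib-+ f g) (sym (cong₂ ℕ._+_ (sumℕ≡sum f) (sumℕ≡sum g))))

  sumℕ-comm : (f : Fin n → Fin n → ℕ) →
    sumℕ (λ i → sumℕ (f i)) ≡ sumℕ (λ j → sumℕ (λ i → f i j))
  sumℕ-comm f = trans (sumℕ²≡sum² f) (trans (ℕΣ.∑-comm f) (sym (sumℕ²≡sum² (λ j i → f i j))))
    where
    sumℕ²≡sum² : (g : Fin n → Fin n → ℕ) → sumℕ (λ i → sumℕ (g i)) ≡ ℕΣ.sum (λ i → ℕΣ.sum (g i))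
    sumℕ²≡sum² g = trans (sumℕ≡sum (λ i → sumℕ (g i))) (ℕΣ.sum-cong-≗ (λ i → sumℕ≡sum (g i)))

-- A record rather than a function type, so that A and B are inferable from a proof.
infix 4 _≐_
record _≐_ {n} (A B : Matrix n) : Set where
  constructor mk≐
  field at : ∀ i j → A i j ≡ B i j
open _≐_ public

≐-setoid : ℕ → Setoid 0ℓ 0ℓ
≐-setoid n = record
  { Carrier = Matrix n
  ; _≈_ = _≐_
  ; isEquivalence = record
    { refl  = mk≐ λ i j → refl
    ; sym   = λ A≐B → mk≐ λ i j → sym (at A≐B i j)
    ; trans = λ A≐B B≐C → mk≐ λ i j → trans (at A≐B i j) (at B≐C i j) } }

module ≐-Reasoning {n : ℕ} = SetoidReasoning (≐-setoid n)

infixl 7 _·_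
_·_ : ∀ {n} → ℚ → Matrix n → Matrix n
(c · A) i j = c * A i j

tr : ∀ {n} → Matrix n → ℚ
tr A = sumℚ λ i → A i i

inner : ∀ {n} → Matrix n → Matrix n → ℚ
inner A B = sumℚ λ i → sumℚ λ j → A i j * B i j

Symmetric : ∀ {n} → Matrix n → Set
Symmetric A = transpose A ≐ A

ZeroRowSums : ∀ {n} → Matrix n → Set
ZeroRowSums A = ∀ i → sumℚ (A i) ≡ 0ℚ

module _ {n : ℕ} where
  open Setoid (≐-setoid n) public using () renaming (sym to ≐-sym; trans to ≐-trans)
  open ≡-Reasoning

  ⊗-cong : {A A′ B B′ : Matrix n} → A ≐ A′ → B ≐ B′ → A ⊗ B ≐ A′ ⊗ B′
  ⊗-cong A≐A′ B≐B′ = mk≐ λ i j → sum-cong λ k → cong₂ _*_ (at A≐A′ i k) (at B≐B′ k j)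

  ⊗-congˡ : {A A′ : Matrix n} (B : Matrix n) → A ≐ A′ → A ⊗ B ≐ A′ ⊗ B
  ⊗-congˡ B A≐A′ = ⊗-cong A≐A′ (mk≐ λ i j → refl {x = B i j})

  ⊗-congʳ : (A : Matrix n) {B B′ : Matrix n} → B ≐ B′ → A ⊗ B ≐ A ⊗ B′
  ⊗-congʳ A B≐B′ = ⊗-cong (mk≐ λ i j → refl {x = A i j}) B≐B′

  ·-congʳ : (c : ℚ) {A B : Matrix n} → A ≐ B → c · A ≐ c · B
  ·-congʳ c A≐B = mk≐ λ i j → cong (c *_) (at A≐B i j)

  transpose-cong : {A B : Matrix n} → A ≐ B → transpose A ≐ transpose B
  transpose-cong A≐B = mk≐ λ i j → at A≐B j i

  tr-cong : {A B : Matrix n} → A ≐ B → tr A ≡ tr B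
  tr-cong A≐B = sum-cong λ i → at A≐B i i

  ⊗-assoc : (A B C : Matrix n) → (A ⊗ B) ⊗ C ≐ A ⊗ (B ⊗ C)
  ⊗-assoc A B C = mk≐ λ i j → begin
    sumℚ (λ k → sumℚ (λ l → A i l * B l k) * C k j)
      ≡⟨ sum-cong (λ k → *-distribʳ-sum (C k j) (λ l → A i l * B l k)) ⟩
    sumℚ (λ k → sumℚ (λ l → A i l * B l k * C k j))
      ≡⟨ sum-comm (λ k l → A i l * B l k * C k j) ⟩
    sumℚ (λ l → sumℚ (λ k → A i l * B l k * C k j))
      ≡⟨ sum-cong (λ l → sum-cong (λ k → ℚ.*-assoc (A i l) (B l k) (C k j))) ⟩
    sumℚ (λ l → sumℚ (λ k → A i l * (B l k * C k j)))
      ≡⟨ sum-cong (λ l → *-distribˡ-sum (A i l) (λ k → B l k * C k j)) ⟨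
    sumℚ (λ l → A i l * sumℚ (λ k → B l k * C k j)) ∎

  transpose-⊗ : (A B : Matrix n) → transpose (A ⊗ B) ≐ transpose B ⊗ transpose A
  transpose-⊗ A B = mk≐ λ i j → sum-cong λ k → ℚ.*-comm (A j k) (B k i)

  ·-⊗ : (c : ℚ) (A B : Matrix n) → (c · A) ⊗ B ≐ c · (A ⊗ B)
  ·-⊗ c A B = mk≐ λ i j →
    trans (sum-cong λ k → ℚ.*-assoc c (A i k) (B k j)) (sym (*-distribˡ-sum c (λ k → A i k * B k j)))

  ⊗-· : (c : ℚ) (A B : Matrix n) → A ⊗ (c · B) ≐ c · (A ⊗ B)
  ⊗-· c A B = mk≐ λ i j →
    trans (sum-cong λ k → a[cb]≡c[ab] (A i k) c (B k j)) (sym (*-distribˡ-sum c (λ k → A i k * B k j)))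
    where
    a[cb]≡c[ab] : ∀ a c b → a * (c * b) ≡ c * (a * b)
    a[cb]≡c[ab] = solve-∀ ℚ-ring

  tr-· : (c : ℚ) (A : Matrix n) → tr (c · A) ≡ c * tr A
  tr-· c A = sym (*-distribˡ-sum c (λ i → A i i))

  -- inner A B is definitionally tr (A ⊗ transpose B).
  inner-symmetricʳ : (A : Matrix n) {B : Matrix n} → Symmetric B → inner A B ≡ tr (A ⊗ B)
  inner-symmetricʳ A B-sym = tr-cong (⊗-congʳ A B-sym)

  zeroRowSums-⊗ : (A : Matrix n) {B : Matrix n} → ZeroRowSums B → ZeroRowSums (A ⊗ B)
  zeroRowSums-⊗ A {B} B-rows i = begin
    sumℚ (λ j → sumℚ (λ k → A i k * B k j)) ≡⟨ sum-comm (λ j k → A i k * B k j) ⟩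
    sumℚ (λ k → sumℚ (λ j → A i k * B k j)) ≡⟨ sum-cong (λ k → *-distribˡ-sum (A i k) (B k)) ⟨
    sumℚ (λ k → A i k * sumℚ (B k))
      ≡⟨ sum-zero (λ k → trans (cong (A i k *_) (B-rows k)) (ℚ.*-zeroʳ (A i k))) ⟩
    0ℚ                                       ∎

  zeroRowSums-cong : {A B : Matrix n} → A ≐ B → ZeroRowSums A → ZeroRowSums B
  zeroRowSums-cong A≐B A-rows i = trans (sum-cong λ j → sym (at A≐B i j)) (A-rows i)

  proportional⇒multiple : {B A : Matrix n} → (∀ i j k l → B i j * A k l ≡ B k l * A i j) →
    ∀ {u w r} → A u w * r ≡ 1ℚ → B ≐ (B u w * r) · A
  proportional⇒multiple {B} {A} B∥A {u} {w} {r} Auw*r≡1 = mk≐ λ i j → begin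
    B i j                    ≡⟨ ℚ.*-identityʳ (B i j) ⟨
    B i j * 1ℚ               ≡⟨ cong (B i j *_) Auw*r≡1 ⟨
    B i j * (A u w * r)      ≡⟨ ℚ.*-assoc (B i j) (A u w) r ⟨
    (B i j * A u w) * r      ≡⟨ cong (_* r) (B∥A i j u w) ⟩
    (B u w * A i j) * r      ≡⟨ xy*r≡xr*y (B u w) (A i j) r ⟩
    (B u w * r) * A i j      ∎
    where
    open ≡-Reasoning
    xy*r≡xr*y : ∀ x y r → (x * y) * r ≡ (x * r) * y
    xy*r≡xr*y = solve-∀ ℚ-ring

-- Cauchy–Schwarz for the Frobenius inner product, via Lagrange's identity (no square roots in ℚ)

module CauchySchwarz {n : ℕ} where
  open ≡-Reasoning

  ∑∑ : (Fin n → Fin n → ℚ) → ℚ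
  ∑∑ f = sumℚ λ i → sumℚ (f i)

  ∑∑-cong : {f g : Fin n → Fin n → ℚ} → (∀ i j → f i j ≡ g i j) → ∑∑ f ≡ ∑∑ g
  ∑∑-cong f≗g = sum-cong λ i → sum-cong (f≗g i)

  ∑∑-linear : (f g h : Fin n → Fin n → ℚ) (α β γ : ℚ) →
    ∑∑ (λ i j → α * f i j + β * g i j + γ * h i j) ≡ α * ∑∑ f + β * ∑∑ g + γ * ∑∑ h
  ∑∑-linear f g h α β γ = begin
    ∑∑ (λ i j → α * f i j + β * g i j + γ * h i j)
      ≡⟨ sum-cong (λ i → sum-distrib-+₃ (λ j → α * f i j) (λ j → β * g i j) (λ j → γ * h i j)) ⟩
    sumℚ (λ i → sumℚ (λ j → α * f i j) + sumℚ (λ j → β * g i j) + sumℚ (λ j → γ * h i j))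
      ≡⟨ sum-distrib-+₃ (λ i → sumℚ (λ j → α * f i j)) (λ i → sumℚ (λ j → β * g i j))
                        (λ i → sumℚ (λ j → γ * h i j)) ⟩
    ∑∑ (λ i j → α * f i j) + ∑∑ (λ i j → β * g i j) + ∑∑ (λ i j → γ * h i j)
      ≡⟨ cong₂ _+_ (cong₂ _+_ (∑∑-*ˡ α f) (∑∑-*ˡ β g)) (∑∑-*ˡ γ h) ⟨
    α * ∑∑ f + β * ∑∑ g + γ * ∑∑ h ∎
    where
    sum-distrib-+₃ : (a b c : Fin n → ℚ) → sumℚ (λ i → a i + b i + c i) ≡ sumℚ a + sumℚ b + sumℚ c
    sum-distrib-+₃ a b c =
      trans (sum-distrib-+ (λ i → a i + b i) c) (cong (_+ sumℚ c) (sum-distrib-+ a b))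
    ∑∑-*ˡ : ∀ c (k : Fin n → Fin n → ℚ) → c * ∑∑ k ≡ ∑∑ (λ i j → c * k i j)
    ∑∑-*ˡ c k = trans (*-distribˡ-sum c (λ i → sumℚ (k i))) (sum-cong λ i → *-distribˡ-sum c (k i))

  ∑∑-nonNeg : {f : Fin n → Fin n → ℚ} → (∀ i j → 0ℚ ≤ f i j) → 0ℚ ≤ ∑∑ f
  ∑∑-nonNeg 0≤f = sum-nonNeg λ i → sum-nonNeg (0≤f i)

  ∑∑≡0⇒term≡0 : {f : Fin n → Fin n → ℚ} → (∀ i j → 0ℚ ≤ f i j) → ∑∑ f ≡ 0ℚ → ∀ i j → f i j ≡ 0ℚ
  ∑∑≡0⇒term≡0 0≤f ∑∑≡0 i =
    sum≡0⇒term≡0 (0≤f i) (sum≡0⇒term≡0 (λ i → sum-nonNeg (0≤f i)) ∑∑≡0 i)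

  module _ (A B : Matrix n) where
    private
      α β γ : ℚ
      α = inner A A
      β = inner B B
      γ = inner A B

    minor² : Fin n → Fin n → Fin n → Fin n → ℚ
    minor² i j k l = (A i j * B k l - A k l * B i j) * (A i j * B k l - A k l * B i j)

    lagrange-identity : ∑∑ (λ i j → ∑∑ (minor² i j)) ≡ (α * β - γ * γ) + (α * β - γ * γ)
    lagrange-identity = begin
      ∑∑ (λ i j → ∑∑ (minor² i j))
        ≡⟨ ∑∑-cong (λ i j → ∑∑-cong (λ k l → expand (A i j) (B i j) (A k l) (B k l))) ⟩
      ∑∑ (λ i j → ∑∑ (λ k l → (A i j * A i j) * (B k l * B k l) + (B i j * B i j) * (A k l * A k l)
                              + (- (A i j * B i j + A i j * B i j)) * (A k l * B k l)))
        ≡⟨ ∑∑-cong (λ i j → ∑∑-linear BB AA AB (A i j * A i j) (B i j * B i j)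
                                                (- (A i j * B i j + A i j * B i j))) ⟩
      ∑∑ (λ i j → (A i j * A i j) * β + (B i j * B i j) * α + (- (A i j * B i j + A i j * B i j)) * γ)
        ≡⟨ ∑∑-cong (λ i j → reorder (A i j) (B i j) α β γ) ⟩
      ∑∑ (λ i j → β * (A i j * A i j) + α * (B i j * B i j) + (- (γ + γ)) * (A i j * B i j))
        ≡⟨ ∑∑-linear AA BB AB β α (- (γ + γ)) ⟩
      β * α + α * β + (- (γ + γ)) * γ
        ≡⟨ collect α β γ ⟩
      (α * β - γ * γ) + (α * β - γ * γ) ∎
      where
      AA BB AB : Fin n → Fin n → ℚ
      AA k l = A k l * A k l
      BB k l = B k l * B k l
      AB k l = A k l * B k l
      expand : ∀ x y x′ y′ → (x * y′ - x′ * y) * (x * y′ - x′ * y) ≡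
        (x * x) * (y′ * y′) + (y * y) * (x′ * x′) + (- (x * y + x * y)) * (x′ * y′)
      expand = solve-∀ ℚ-ring
      reorder : ∀ x y α β γ → (x * x) * β + (y * y) * α + (- (x * y + x * y)) * γ ≡
        β * (x * x) + α * (y * y) + (- (γ + γ)) * (x * y)
      reorder = solve-∀ ℚ-ring
      collect : ∀ α β γ → β * α + α * β + (- (γ + γ)) * γ ≡ (α * β - γ * γ) + (α * β - γ * γ)
      collect = solve-∀ ℚ-ring

    minor²-nonNeg : ∀ i j k l → 0ℚ ≤ minor² i j k l
    minor²-nonNeg i j k l = x*x-nonNeg (A i j * B k l - A k l * B i j)

    cauchy-schwarz : inner A B * inner A B ≤ inner A A * inner B B
    cauchy-schwarz = 0≤x-y⇒y≤x (α * β) (γ * γ) (0≤x+x⇒0≤x (α * β - γ * γ)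
      (subst (0ℚ ≤_) lagrange-identity (∑∑-nonNeg λ i j → ∑∑-nonNeg (minor²-nonNeg i j))))

    cauchy-schwarz-≡ : inner A B * inner A B ≡ inner A A * inner B B →
      ∀ i j k l → A i j * B k l ≡ A k l * B i j
    cauchy-schwarz-≡ γ²≡αβ i j k l = x∙y⁻¹≈ε⇒x≈y _ _ (x*x≡0⇒x≡0 _
      (∑∑≡0⇒term≡0 (minor²-nonNeg i j)
        (∑∑≡0⇒term≡0 (λ i j → ∑∑-nonNeg (minor²-nonNeg i j)) ∑∑≡0 i j) k l))
      where
      αβ-γ²≡0 : α * β - γ * γ ≡ 0ℚ
      αβ-γ²≡0 = x≈y⇒x∙y⁻¹≈ε (sym γ²≡αβ)
      ∑∑≡0 : ∑∑ (λ i j → ∑∑ (minor² i j)) ≡ 0ℚ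
      ∑∑≡0 = trans lagrange-identity (trans (cong₂ _+_ αβ-γ²≡0 αβ-γ²≡0) (ℚ.+-identityʳ 0ℚ))

module _ {n : ℕ} where
  open ≐-Reasoning

  module Penrose {A X : Matrix n} (pinv : IsPseudoInverse A X) where
    AXA≐A : A ⊗ (X ⊗ A) ≐ A
    AXA≐A = mk≐ (proj₁ pinv)

    XAX≐X : X ⊗ (A ⊗ X) ≐ X
    XAX≐X = mk≐ (proj₁ (proj₂ pinv))

    AX-sym : Symmetric (A ⊗ X)
    AX-sym = mk≐ (proj₁ (proj₂ (proj₂ pinv)))

    XA-sym : Symmetric (X ⊗ A)
    XA-sym = mk≐ (proj₂ (proj₂ (proj₂ pinv)))

  transpose-⊗-⊗ : (A B C : Matrix n) →
    transpose (A ⊗ (B ⊗ C)) ≐ transpose C ⊗ (transpose B ⊗ transpose A)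
  transpose-⊗-⊗ A B C = begin
    transpose (A ⊗ (B ⊗ C))                   ≈⟨ transpose-⊗ A (B ⊗ C) ⟩
    transpose (B ⊗ C) ⊗ transpose A           ≈⟨ ⊗-congˡ (transpose A) (transpose-⊗ B C) ⟩
    (transpose C ⊗ transpose B) ⊗ transpose A ≈⟨ ⊗-assoc (transpose C) (transpose B) (transpose A) ⟩
    transpose C ⊗ (transpose B ⊗ transpose A) ∎

  symmetric-⊗-transpose : {B C : Matrix n} → Symmetric (B ⊗ C) → Symmetric (transpose C ⊗ transpose B)
  symmetric-⊗-transpose {B} {C} BC-sym = begin
    transpose (transpose C ⊗ transpose B) ≈⟨ transpose-⊗ (transpose C) (transpose B) ⟩
    B ⊗ C                                 ≈⟨ BC-sym ⟨
    transpose (B ⊗ C)                     ≈⟨ transpose-⊗ B C ⟩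
    transpose C ⊗ transpose B             ∎

  pinv-transpose : {A X : Matrix n} → IsPseudoInverse A X →
                   IsPseudoInverse (transpose A) (transpose X)
  pinv-transpose {A} {X} pinv =
    at (≐-trans (≐-sym (transpose-⊗-⊗ A X A)) (transpose-cong AXA≐A)) ,
    at (≐-trans (≐-sym (transpose-⊗-⊗ X A X)) (transpose-cong XAX≐X)) ,
    at (symmetric-⊗-transpose {X} {A} XA-sym) ,
    at (symmetric-⊗-transpose {A} {X} AX-sym)
    where open Penrose pinv

  pinv-cong : {A B X : Matrix n} → A ≐ B → IsPseudoInverse A X → IsPseudoInverse B X
  pinv-cong {A} {B} {X} A≐B pinv =
    at (≐-trans (≐-sym (⊗-cong A≐B (⊗-congʳ X A≐B))) (≐-trans AXA≐A A≐B)) ,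
    at (≐-trans (≐-sym (⊗-congʳ X (⊗-congˡ X A≐B))) XAX≐X) ,
    at (≐-trans (≐-sym (transpose-cong (⊗-congˡ X A≐B))) (≐-trans AX-sym (⊗-congˡ X A≐B))) ,
    at (≐-trans (≐-sym (transpose-cong (⊗-congʳ X A≐B))) (≐-trans XA-sym (⊗-congʳ X A≐B)))
    where open Penrose pinv

  pinv-unique : {A X Y : Matrix n} → IsPseudoInverse A X → IsPseudoInverse A Y → X ≐ Y
  pinv-unique {A} {X} {Y} pinvX pinvY = ≐-trans X≐XAY (≐-sym Y≐XAY)
    where
    module PX = Penrose pinvX
    module PY = Penrose pinvY
    module PXᵀ = Penrose (pinv-transpose pinvX)
    module PYᵀ = Penrose (pinv-transpose pinvY)
    Aᵀ Xᵀ Yᵀ : Matrix n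
    Aᵀ = transpose A
    Xᵀ = transpose X
    Yᵀ = transpose Y
    XᵀAᵀ≐AX : Xᵀ ⊗ Aᵀ ≐ A ⊗ X
    XᵀAᵀ≐AX = ≐-trans (≐-sym (transpose-⊗ A X)) PX.AX-sym
    YᵀAᵀ≐AY : Yᵀ ⊗ Aᵀ ≐ A ⊗ Y
    YᵀAᵀ≐AY = ≐-trans (≐-sym (transpose-⊗ A Y)) PY.AX-sym
    AᵀXᵀ≐XA : Aᵀ ⊗ Xᵀ ≐ X ⊗ A
    AᵀXᵀ≐XA = ≐-trans (≐-sym (transpose-⊗ X A)) PX.XA-sym
    AᵀYᵀ≐YA : Aᵀ ⊗ Yᵀ ≐ Y ⊗ A
    AᵀYᵀ≐YA = ≐-trans (≐-sym (transpose-⊗ Y A)) PY.XA-sym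
    X≐XAY : X ≐ X ⊗ (A ⊗ Y)
    X≐XAY = begin
      X                                ≈⟨ PX.XAX≐X ⟨
      X ⊗ (A ⊗ X)                      ≈⟨ ⊗-congʳ X XᵀAᵀ≐AX ⟨
      X ⊗ (Xᵀ ⊗ Aᵀ)                    ≈⟨ ⊗-congʳ X (⊗-congʳ Xᵀ PYᵀ.AXA≐A) ⟨
      X ⊗ (Xᵀ ⊗ (Aᵀ ⊗ (Yᵀ ⊗ Aᵀ)))      ≈⟨ ⊗-congʳ X (⊗-assoc Xᵀ Aᵀ (Yᵀ ⊗ Aᵀ)) ⟨
      X ⊗ ((Xᵀ ⊗ Aᵀ) ⊗ (Yᵀ ⊗ Aᵀ))      ≈⟨ ⊗-congʳ X (⊗-cong XᵀAᵀ≐AX YᵀAᵀ≐AY) ⟩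
      X ⊗ ((A ⊗ X) ⊗ (A ⊗ Y))          ≈⟨ ⊗-assoc X (A ⊗ X) (A ⊗ Y) ⟨
      (X ⊗ (A ⊗ X)) ⊗ (A ⊗ Y)          ≈⟨ ⊗-congˡ (A ⊗ Y) PX.XAX≐X ⟩
      X ⊗ (A ⊗ Y)                      ∎
    Y≐XAY : Y ≐ X ⊗ (A ⊗ Y)
    Y≐XAY = begin
      Y                                ≈⟨ PY.XAX≐X ⟨
      Y ⊗ (A ⊗ Y)                      ≈⟨ ⊗-assoc Y A Y ⟨
      (Y ⊗ A) ⊗ Y                      ≈⟨ ⊗-congˡ Y AᵀYᵀ≐YA ⟨
      (Aᵀ ⊗ Yᵀ) ⊗ Y                    ≈⟨ ⊗-congˡ Y (⊗-congˡ Yᵀ PXᵀ.AXA≐A) ⟨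
      ((Aᵀ ⊗ (Xᵀ ⊗ Aᵀ)) ⊗ Yᵀ) ⊗ Y      ≈⟨ ⊗-congˡ Y (⊗-congˡ Yᵀ (⊗-assoc Aᵀ Xᵀ Aᵀ)) ⟨
      (((Aᵀ ⊗ Xᵀ) ⊗ Aᵀ) ⊗ Yᵀ) ⊗ Y      ≈⟨ ⊗-congˡ Y (⊗-assoc (Aᵀ ⊗ Xᵀ) Aᵀ Yᵀ) ⟩
      ((Aᵀ ⊗ Xᵀ) ⊗ (Aᵀ ⊗ Yᵀ)) ⊗ Y      ≈⟨ ⊗-congˡ Y (⊗-cong AᵀXᵀ≐XA AᵀYᵀ≐YA) ⟩
      ((X ⊗ A) ⊗ (Y ⊗ A)) ⊗ Y          ≈⟨ ⊗-assoc (X ⊗ A) (Y ⊗ A) Y ⟩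
      (X ⊗ A) ⊗ ((Y ⊗ A) ⊗ Y)          ≈⟨ ⊗-congʳ (X ⊗ A) (⊗-assoc Y A Y) ⟩
      (X ⊗ A) ⊗ (Y ⊗ (A ⊗ Y))          ≈⟨ ⊗-congʳ (X ⊗ A) PY.XAX≐X ⟩
      (X ⊗ A) ⊗ Y                      ≈⟨ ⊗-assoc X A Y ⟩
      X ⊗ (A ⊗ Y)                      ∎

module SymmetricPseudoInverse {n : ℕ} {A X : Matrix n}
                              (A-sym : Symmetric A) (pinv : IsPseudoInverse A X) where
  open Penrose pinv
  open CauchySchwarz

  P : Matrix n
  P = A ⊗ X

  X-sym : Symmetric X
  X-sym = pinv-unique (pinv-cong A-sym (pinv-transpose pinv)) pinv

  XA≐P : X ⊗ A ≐ P
  XA≐P = begin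
    X ⊗ A                     ≈⟨ XA-sym ⟨
    transpose (X ⊗ A)         ≈⟨ transpose-⊗ X A ⟩
    transpose A ⊗ transpose X ≈⟨ ⊗-cong A-sym X-sym ⟩
    A ⊗ X                     ∎
    where open ≐-Reasoning

  X≐XXA : X ≐ (X ⊗ X) ⊗ A
  X≐XXA = begin
    X            ≈⟨ XAX≐X ⟨
    X ⊗ (A ⊗ X)  ≈⟨ ⊗-congʳ X XA≐P ⟨
    X ⊗ (X ⊗ A)  ≈⟨ ⊗-assoc X X A ⟨
    (X ⊗ X) ⊗ A  ∎
    where open ≐-Reasoning

  PA≐A : P ⊗ A ≐ A
  PA≐A = ≐-trans (⊗-assoc A X A) AXA≐A

  AP≐A : A ⊗ P ≐ A
  AP≐A = ≐-trans (⊗-congʳ A (≐-sym XA≐P)) AXA≐A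

  PP≐P : P ⊗ P ≐ P
  PP≐P = ≐-trans (≐-sym (⊗-assoc P A X)) (⊗-congˡ X PA≐A)

  zeroRowSums-pinv : ZeroRowSums A → ZeroRowSums X
  zeroRowSums-pinv A-rows = zeroRowSums-cong (≐-sym X≐XXA) (zeroRowSums-⊗ (X ⊗ X) A-rows)

  inner-PA : inner P A ≡ tr A
  inner-PA = trans (inner-symmetricʳ P A-sym) (tr-cong PA≐A)

  inner-PP : inner P P ≡ tr P
  inner-PP = trans (inner-symmetricʳ P AX-sym) (tr-cong PP≐P)

  inner-XA : inner X A ≡ tr P
  inner-XA = trans (inner-symmetricʳ X A-sym) (tr-cong XA≐P)

  private
    a b c : ℚ
    a = inner X X
    b = tr A
    c = inner A A

  tr²≤trP*inner : b * b ≤ tr P * c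
  tr²≤trP*inner = subst₂ _≤_ (cong₂ _*_ inner-PA inner-PA) (cong (_* c) inner-PP) (cauchy-schwarz P A)

  trP²≤inner*inner : tr P * tr P ≤ a * c
  trP²≤inner*inner = subst (_≤ a * c) (cong₂ _*_ inner-XA inner-XA) (cauchy-schwarz X A)

  [trP*inner]²≤inner*inner³ : (tr P * c) * (tr P * c) ≤ (a * c) * (c * c)
  [trP*inner]²≤inner*inner³ = subst (_≤ (a * c) * (c * c)) (sym (xy*xy≡xx*yy (tr P) c))
    (ℚ.*-monoʳ-≤-nonNeg (c * c) {{ℚ.nonNegative (x*x-nonNeg c)}} trP²≤inner*inner)
    where
    xy*xy≡xx*yy : ∀ x y → (x * y) * (x * y) ≡ (x * x) * (y * y)
    xy*xy≡xx*yy = solve-∀ ℚ-ring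

  trace⁴-bound : (b * b) * (b * b) ≤ (a * c) * (c * c)
  trace⁴-bound = ℚ.≤-trans (x*x-mono-≤ (x*x-nonNeg b) tr²≤trP*inner) [trP*inner]²≤inner*inner³

  trace⁴-bound-tight⇒proportional : (b * b) * (b * b) ≡ (a * c) * (c * c) →
    ∀ i j k l → P i j * A k l ≡ P k l * A i j
  trace⁴-bound-tight⇒proportional b⁴≡ac³ = cauchy-schwarz-≡ P A
    (trans (cong₂ _*_ inner-PA inner-PA) (trans b²≡trP*c (cong (_* c) (sym inner-PP))))
    where
    b⁴≡[trP*c]² : (b * b) * (b * b) ≡ (tr P * c) * (tr P * c)
    b⁴≡[trP*c]² = ℚ.≤-antisym (x*x-mono-≤ (x*x-nonNeg b) tr²≤trP*inner)
      (subst ((tr P * c) * (tr P * c) ≤_) (sym b⁴≡ac³) [trP*inner]²≤inner*inner³)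
    b²≡trP*c : b * b ≡ tr P * c
    b²≡trP*c = x*x≡y*y⇒x≡y (x*x-nonNeg b) (ℚ.≤-trans (x*x-nonNeg b) tr²≤trP*inner) b⁴≡[trP*c]²

  module _ (ν : ℚ) (ν≢0 : ν ≢ 0ℚ) (AA≐νA : A ⊗ A ≐ ν · A) where

    νP≐A : ν · P ≐ A
    νP≐A = begin
      ν · (A ⊗ X)  ≈⟨ ·-⊗ ν A X ⟨
      (ν · A) ⊗ X  ≈⟨ ⊗-congˡ X AA≐νA ⟨
      (A ⊗ A) ⊗ X  ≈⟨ ⊗-assoc A A X ⟩
      A ⊗ P        ≈⟨ AP≐A ⟩
      A            ∎
      where open ≐-Reasoning

    νX≐P : ν · X ≐ P
    νX≐P = begin
      ν · X            ≈⟨ ·-congʳ ν XAX≐X ⟨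
      ν · (X ⊗ P)      ≈⟨ ⊗-· ν X P ⟨
      X ⊗ (ν · P)      ≈⟨ ⊗-congʳ X νP≐A ⟩
      X ⊗ A            ≈⟨ XA≐P ⟩
      P                ∎
      where open ≐-Reasoning

    A≐ν²X : A ≐ ν · (ν · X)
    A≐ν²X = ≐-trans (≐-sym νP≐A) (·-congʳ ν (≐-sym νX≐P))

    c≡ν⁴a : c ≡ ((ν * ν) * (ν * ν)) * a
    c≡ν⁴a = trans (sum-cong λ i → sum-cong λ j → trans (cong₂ _*_ (at A≐ν²X i j) (at A≐ν²X i j))
                                                       (ν[νx]*ν[νx] ν (X i j)))
                  (sym (trans (*-distribˡ-sum ν⁴ (λ i → sumℚ λ j → X i j * X i j))
                              (sum-cong λ i → *-distribˡ-sum ν⁴ (λ j → X i j * X i j))))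
      where
      ν⁴ : ℚ
      ν⁴ = (ν * ν) * (ν * ν)
      ν[νx]*ν[νx] : ∀ ν x → (ν * (ν * x)) * (ν * (ν * x)) ≡ ((ν * ν) * (ν * ν)) * (x * x)
      ν[νx]*ν[νx] = solve-∀ ℚ-ring

    c≡νb : c ≡ ν * b
    c≡νb = trans (inner-symmetricʳ A A-sym) (trans (tr-cong AA≐νA) (tr-· ν A))

    ν³a≡b : (ν * ν * ν) * a ≡ b
    ν³a≡b = *-cancelˡ-≡ ν ν≢0 (trans (ν*ν³a≡ν⁴a ν a) (trans (sym c≡ν⁴a) c≡νb))
      where
      ν*ν³a≡ν⁴a : ∀ ν a → ν * ((ν * ν * ν) * a) ≡ ((ν * ν) * (ν * ν)) * a
      ν*ν³a≡ν⁴a = solve-∀ ℚ-ring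

    trace⁴-bound-tight : (b * b) * (b * b) ≡ (a * c) * (c * c)
    trace⁴-bound-tight = sym (begin
      (a * c) * (c * c)                      ≡⟨ cong (λ z → (a * z) * (z * z)) c≡νb ⟩
      (a * (ν * b)) * ((ν * b) * (ν * b))    ≡⟨ regroup ν a b ⟩
      ((ν * ν * ν) * a) * (b * (b * b))      ≡⟨ cong (_* (b * (b * b))) ν³a≡b ⟩
      b * (b * (b * b))                      ≡⟨ reassoc b ⟩
      (b * b) * (b * b)                      ∎)
      where
      open ≡-Reasoning
      regroup : ∀ ν a b → (a * (ν * b)) * ((ν * b) * (ν * b)) ≡ ((ν * ν * ν) * a) * (b * (b * b))
      regroup = solve-∀ ℚ-ring
      reassoc : ∀ b → b * (b * (b * b)) ≡ (b * b) * (b * b)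
      reassoc = solve-∀ ℚ-ring

BH≡n*inner : ∀ {n} {X : Matrix n} → Symmetric X → ZeroRowSums X → BH X ≡ toℚ n * inner X X
BH≡n*inner {n} {X} X-sym X-rows = begin
  ½ * sumℚ (λ u → sumℚ (λ v → biharmonicSq X u v)) ≡⟨ cong (½ *_) (sum-cong row-sum) ⟩
  ½ * sumℚ (λ u → ν * Y u u + tr Y)
    ≡⟨ cong (½ *_) (sum-distrib-+ (λ u → ν * Y u u) (λ _ → tr Y)) ⟩
  ½ * (sumℚ (λ u → ν * Y u u) + sumℚ {n} (λ _ → tr Y))
    ≡⟨ cong (½ *_) (cong₂ _+_ (sym (*-distribˡ-sum ν (λ u → Y u u))) (sum-const {n} (tr Y))) ⟩
  ½ * (ν * tr Y + ν * tr Y)                        ≡⟨ half[x+x]≡x (ν * tr Y) ⟩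
  ν * tr Y                                         ≡⟨ cong (ν *_) (inner-symmetricʳ X X-sym) ⟨
  ν * inner X X                                    ∎
  where
  open ≡-Reasoning
  ν : ℚ
  ν = toℚ n
  Y : Matrix n
  Y = X ⊗ X
  Y-rows : ZeroRowSums Y
  Y-rows = zeroRowSums-⊗ X X-rows
  Y-columns : ZeroRowSums (transpose Y)
  Y-columns = zeroRowSums-cong (≐-sym (≐-trans (transpose-⊗ X X) (⊗-cong X-sym X-sym))) Y-rows
  row-sum : ∀ u → sumℚ (λ v → biharmonicSq X u v) ≡ ν * Y u u + tr Y
  row-sum u = begin
    sumℚ (λ v → Y u u + Y v v - Y u v - Y v u)
      ≡⟨ sum-distrib-+ (λ v → Y u u + Y v v - Y u v) (λ v → - Y v u) ⟩
    sumℚ (λ v → Y u u + Y v v - Y u v) + sumℚ (λ v → - Y v u)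
      ≡⟨ cong₂ _+_ (sum-distrib-+ (λ v → Y u u + Y v v) (λ v → - Y u v)) (sum-neg (λ v → Y v u)) ⟩
    sumℚ (λ v → Y u u + Y v v) + sumℚ (λ v → - Y u v) - sumℚ (λ v → Y v u)
      ≡⟨ cong₂ (λ x y → sumℚ (λ v → Y u u + Y v v) + x - y)
               (trans (sum-neg (Y u)) (cong -_ (Y-rows u))) (Y-columns u) ⟩
    sumℚ (λ v → Y u u + Y v v) + - 0ℚ - 0ℚ
      ≡⟨ x+-0-0≡x (sumℚ (λ v → Y u u + Y v v)) ⟩
    sumℚ (λ v → Y u u + Y v v)
      ≡⟨ trans (sum-distrib-+ (λ _ → Y u u) (λ v → Y v v)) (cong (_+ tr Y) (sum-const {n} (Y u u))) ⟩
    ν * Y u u + tr Y ∎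
    where
    x+-0-0≡x : ∀ x → x + - 0ℚ - 0ℚ ≡ x
    x+-0-0≡x = solve-∀ ℚ-ring
  half[x+x]≡x : ∀ x → ½ * (x + x) ≡ x
  half[x+x]≡x x = trans (h[x+x]≡[h+h]x ½ x) (ℚ.*-identityˡ x)
    where
    h[x+x]≡[h+h]x : ∀ h x → h * (x + x) ≡ (h + h) * x
    h[x+x]≡[h+h]x = solve-∀ ℚ-ring

IsComplete : ∀ {n} → Graph n → Set
IsComplete {n} G = ∀ (u v : Fin n) → u ≢ v → adj G u v ≡ true

module _ {n : ℕ} (G : Graph n) where

  complete⇒≅K : IsComplete G → G ≅ K n
  complete⇒≅K G-complete = ↔-id (Fin n) , λ u v → entry u v (u Fin.≟ v)
    where
    entry : ∀ u v (u≟v : Dec (u ≡ v)) → adj G u v ≡ (if does u≟v then false else true)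
    entry u v (yes refl) = adj-irrefl G u
    entry u v (no u≢v)   = G-complete u v u≢v

  ≅K⇒complete : G ≅ K n → IsComplete G
  ≅K⇒complete (f , f-iso) u v u≢v = trans (f-iso u v)
    (cong (if_then false else true)
          (dec-false (to u Fin.≟ to v) (u≢v ∘ Injection.injective (Inverse⇒Injection f))))
    where open Inverse f using (to)

  connected∧two-step-closed⇒complete : Connected G →
    (∀ {u w v} → adj G u w ≡ true → adj G w v ≡ true → u ≢ v → adj G u v ≡ true) → IsComplete G
  connected∧two-step-closed⇒complete G-connected closed u v u≢v =
    fromInj₂ (⊥-elim ∘ u≢v) (walk⇒≡∨adj (G-connected u v))
    where
    walk⇒≡∨adj : ∀ {u v} → Walk G u v → u ≡ v ⊎ adj G u v ≡ true
    walk⇒≡∨adj here = inj₁ refl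
    walk⇒≡∨adj {u} {v} (step uw w⋯v) with walk⇒≡∨adj w⋯v | u Fin.≟ v
    ... | _           | yes u≡v = inj₁ u≡v
    ... | inj₁ refl   | no _    = inj₂ uw
    ... | inj₂ wv     | no u≢v  = inj₂ (closed uw wv u≢v)

offDiagonal : Bool → ℚ
offDiagonal b = if b then - 1ℚ else 0ℚ

offDiagonal≡-b2ℕ : ∀ b → offDiagonal b ≡ - toℚ (b2ℕ b)
offDiagonal≡-b2ℕ true  = refl
offDiagonal≡-b2ℕ false = refl

offDiagonal²≡b2ℕ : ∀ b → offDiagonal b * offDiagonal b ≡ toℚ (b2ℕ b)
offDiagonal²≡b2ℕ true  = refl
offDiagonal²≡b2ℕ false = refl

module Laplacian {n : ℕ} (G : Graph n) where
  open ≡-Reasoning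

  L : Matrix n
  L = laplacian G

  L-diagonal : ∀ i → L i i ≡ toℚ (deg G i)
  L-diagonal i = cong (if_then toℚ (deg G i) else offDiagonal (adj G i i)) (dec-true (i Fin.≟ i) refl)

  L-offDiagonal : ∀ {i j} → i ≢ j → L i j ≡ offDiagonal (adj G i j)
  L-offDiagonal {i} {j} i≢j =
    cong (if_then toℚ (deg G i) else offDiagonal (adj G i j)) (dec-false (i Fin.≟ j) i≢j)

  adjacent⇒≢ : ∀ {u v} → adj G u v ≡ true → u ≢ v
  adjacent⇒≢ {u} uv refl with trans (sym uv) (adj-irrefl G u)
  ... | ()

  L-adjacent : ∀ {u v} → adj G u v ≡ true → L u v ≡ - 1ℚ
  L-adjacent uv = trans (L-offDiagonal (adjacent⇒≢ uv)) (cong offDiagonal uv)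

  L-nonadjacent : ∀ {u v} → u ≢ v → adj G u v ≡ false → L u v ≡ 0ℚ
  L-nonadjacent u≢v ¬uv = trans (L-offDiagonal u≢v) (cong offDiagonal ¬uv)

  L-sym : Symmetric L
  L-sym = mk≐ L-entry-sym
    where
    L-entry-sym : ∀ i j → L j i ≡ L i j
    L-entry-sym i j = by-cases (i Fin.≟ j)
      where
      by-cases : Dec (i ≡ j) → L j i ≡ L i j
      by-cases (yes refl) = refl
      by-cases (no i≢j) = begin
        L j i                    ≡⟨ L-offDiagonal (i≢j ∘ sym) ⟩
        offDiagonal (adj G j i)  ≡⟨ cong offDiagonal (adj-sym G j i) ⟩
        offDiagonal (adj G i j)  ≡⟨ L-offDiagonal i≢j ⟨
        L i j                    ∎

  L-zeroRowSums : ZeroRowSums L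
  L-zeroRowSums i = begin
    sumℚ (L i)
      ≡⟨ sum-override i (λ _ → toℚ (deg G i)) (offDiagonal ∘ adj G i)
                      (cong offDiagonal (adj-irrefl G i)) ⟩
    toℚ (deg G i) + sumℚ (offDiagonal ∘ adj G i)
      ≡⟨ cong (toℚ (deg G i) +_)
              (trans (sum-cong (offDiagonal≡-b2ℕ ∘ adj G i)) (sum-neg (toℚ ∘ b2ℕ ∘ adj G i))) ⟩
    toℚ (deg G i) - sumℚ (toℚ ∘ b2ℕ ∘ adj G i)
      ≡⟨ cong (λ d → toℚ (deg G i) - d) (toℚ-sum (b2ℕ ∘ adj G i)) ⟨
    toℚ (deg G i) - toℚ (deg G i)
      ≡⟨ ℚ.+-inverseʳ (toℚ (deg G i)) ⟩
    0ℚ ∎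

  edgeFrom : Fin n → Fin n → ℕ
  edgeFrom u v = b2ℕ (if toℕ u ℕ.<ᵇ toℕ v then adj G u v else false)

  adj≡[u<v]+[v<u] : ∀ u v → b2ℕ (adj G u v) ≡ edgeFrom u v ℕ.+ edgeFrom v u
  adj≡[u<v]+[v<u] u v with toℕ u ℕ.<ᵇ toℕ v in u<ᵇv | toℕ v ℕ.<ᵇ toℕ u in v<ᵇu
  ... | true  | true  = ⊥-elim (ℕ.<-asym (ℕ.<ᵇ⇒< (toℕ u) (toℕ v) (subst T (sym u<ᵇv) tt))
                                         (ℕ.<ᵇ⇒< (toℕ v) (toℕ u) (subst T (sym v<ᵇu) tt)))
  ... | true  | false = sym (ℕ.+-identityʳ _)
  ... | false | true  = cong b2ℕ (adj-sym G u v)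
  ... | false | false = trans (cong (b2ℕ ∘ adj G u) (sym u≡v)) (cong b2ℕ (adj-irrefl G u))
    where
    u≡v : u ≡ v
    u≡v = Fin.toℕ-injective (ℕ.≤-antisym (ℕ.≮⇒≥ λ v<u → subst T v<ᵇu (ℕ.<⇒<ᵇ v<u))
                                         (ℕ.≮⇒≥ λ u<v → subst T u<ᵇv (ℕ.<⇒<ᵇ u<v)))

  handshake : sumℕ (deg G) ≡ 2 ℕ.* edges G
  handshake = begin
    sumℕ (λ u → sumℕ (λ v → b2ℕ (adj G u v)))
      ≡⟨ sumℕ-cong (λ u → sumℕ-cong (adj≡[u<v]+[v<u] u)) ⟩
    sumℕ (λ u → sumℕ (λ v → edgeFrom u v ℕ.+ edgeFrom v u))
      ≡⟨ sumℕ-cong (λ u → sumℕ-distrib-+ (edgeFrom u) (λ v → edgeFrom v u)) ⟩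
    sumℕ (λ u → sumℕ (edgeFrom u) ℕ.+ sumℕ (λ v → edgeFrom v u))
      ≡⟨ sumℕ-distrib-+ (λ u → sumℕ (edgeFrom u)) (λ u → sumℕ (λ v → edgeFrom v u)) ⟩
    edges G ℕ.+ sumℕ (λ u → sumℕ (λ v → edgeFrom v u))
      ≡⟨ cong (edges G ℕ.+_) (sumℕ-comm (λ u v → edgeFrom v u)) ⟩
    edges G ℕ.+ edges G
      ≡⟨ cong (edges G ℕ.+_) (ℕ.+-identityʳ (edges G)) ⟨
    2 ℕ.* edges G ∎

  tr-L : tr L ≡ toℚ (2 ℕ.* edges G)
  tr-L = begin
    sumℚ (λ i → L i i)          ≡⟨ sum-cong L-diagonal ⟩
    sumℚ (λ i → toℚ (deg G i))  ≡⟨ toℚ-sum (deg G) ⟨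
    toℚ (sumℕ (deg G))          ≡⟨ cong toℚ handshake ⟩
    toℚ (2 ℕ.* edges G)         ∎

  L-row-norm² : ∀ i → sumℚ (λ j → L i j * L i j) ≡ toℚ (deg G i ℕ.* deg G i ℕ.+ deg G i)
  L-row-norm² i = begin
    sumℚ (λ j → L i j * L i j)
      ≡⟨ sum-cong (λ j → if-float (λ z → z * z) (does (i Fin.≟ j))) ⟩
    sumℚ (λ j → if does (i Fin.≟ j) then d * d else offDiagonal (adj G i j) * offDiagonal (adj G i j))
      ≡⟨ sum-override i (λ _ → d * d) _ (cong (λ b → offDiagonal b * offDiagonal b) (adj-irrefl G i)) ⟩
    d * d + sumℚ (λ j → offDiagonal (adj G i j) * offDiagonal (adj G i j))
      ≡⟨ cong₂ _+_ (toℚ-* (deg G i) (deg G i))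
                   (trans (sum-cong (offDiagonal²≡b2ℕ ∘ adj G i)) (sym (toℚ-sum (b2ℕ ∘ adj G i)))) ⟩
    toℚ (deg G i ℕ.* deg G i) + toℚ (deg G i)
      ≡⟨ toℚ-+ (deg G i ℕ.* deg G i) (deg G i) ⟩
    toℚ (deg G i ℕ.* deg G i ℕ.+ deg G i) ∎
    where
    d : ℚ
    d = toℚ (deg G i)

  inner-L-L : inner L L ≡ toℚ (2 ℕ.* edges G ℕ.+ M₁ G)
  inner-L-L = begin
    sumℚ (λ i → sumℚ (λ j → L i j * L i j))
      ≡⟨ sum-cong L-row-norm² ⟩
    sumℚ (λ i → toℚ (deg G i ℕ.* deg G i ℕ.+ deg G i))
      ≡⟨ toℚ-sum (λ i → deg G i ℕ.* deg G i ℕ.+ deg G i) ⟨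
    toℚ (sumℕ (λ i → deg G i ℕ.* deg G i ℕ.+ deg G i))
      ≡⟨ cong toℚ (sumℕ-distrib-+ (λ i → deg G i ℕ.* deg G i) (deg G)) ⟩
    toℚ (M₁ G ℕ.+ sumℕ (deg G))
      ≡⟨ cong toℚ (trans (cong (M₁ G ℕ.+_) handshake) (ℕ.+-comm (M₁ G) _)) ⟩
    toℚ (2 ℕ.* edges G ℕ.+ M₁ G) ∎

  offDiagonal²-nonNeg : ∀ b b′ → 0ℚ ≤ offDiagonal b * offDiagonal b′
  offDiagonal²-nonNeg true  true  = toℚ-nonNeg 1
  offDiagonal²-nonNeg true  false = ℚ.≤-refl
  offDiagonal²-nonNeg false true  = ℚ.≤-refl
  offDiagonal²-nonNeg false false = ℚ.≤-refl

  module _ {u w v : Fin n} (uw : adj G u w ≡ true) (wv : adj G w v ≡ true)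
           (u≢v : u ≢ v) (¬uv : adj G u v ≡ false) where

    L²-entry-nonNeg : ∀ k → 0ℚ ≤ L u k * L k v
    L²-entry-nonNeg k = by-cases (k Fin.≟ u) (k Fin.≟ v)
      where
      Luv≡0 : L u v ≡ 0ℚ
      Luv≡0 = L-nonadjacent u≢v ¬uv
      by-cases : Dec (k ≡ u) → Dec (k ≡ v) → 0ℚ ≤ L u k * L k v
      by-cases (yes refl) _ = ℚ.≤-reflexive (sym (trans (cong (L u u *_) Luv≡0) (ℚ.*-zeroʳ (L u u))))
      by-cases (no _) (yes refl) = ℚ.≤-reflexive (sym (trans (cong (_* L v v) Luv≡0) (ℚ.*-zeroˡ (L v v))))
      by-cases (no k≢u) (no k≢v) =
        subst (0ℚ ≤_) (sym (cong₂ _*_ (L-offDiagonal (k≢u ∘ sym)) (L-offDiagonal k≢v)))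
              (offDiagonal²-nonNeg (adj G u k) (adj G k v))

    -- The path u – w – v contributes (-1)(-1) = 1, and no term of the sum is negative.
    1≤L²-nonadjacent : 1ℚ ≤ (L ⊗ L) u v
    1≤L²-nonadjacent = subst (_≤ (L ⊗ L) u v) (cong₂ _*_ (L-adjacent uw) (L-adjacent wv))
                             (term≤sum L²-entry-nonNeg w)

  μL²≐L⇒two-step-closed : (μ : ℚ) → μ · (L ⊗ L) ≐ L →
    ∀ {u w v} → adj G u w ≡ true → adj G w v ≡ true → u ≢ v → adj G u v ≡ true
  μL²≐L⇒two-step-closed μ μL²≐L {u} {w} {v} uw wv u≢v with adj G u v in uv
  ... | true  = refl
  ... | false with x*y≡0⇒x≡0∨y≡0 μ ((L ⊗ L) u v) (trans (at μL²≐L u v) (L-nonadjacent u≢v uv))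
  ...   | inj₁ μ≡0 = ⊥-elim (-1≢0 (begin
          - 1ℚ               ≡⟨ L-adjacent uw ⟨
          L u w              ≡⟨ at μL²≐L u w ⟨
          μ * (L ⊗ L) u w    ≡⟨ cong (_* (L ⊗ L) u w) μ≡0 ⟩
          0ℚ * (L ⊗ L) u w   ≡⟨ ℚ.*-zeroˡ ((L ⊗ L) u w) ⟩
          0ℚ                 ∎))
  ...   | inj₂ L²uv≡0 = ⊥-elim (1≰0 (subst (1ℚ ≤_) L²uv≡0 (1≤L²-nonadjacent uw wv u≢v uv)))

  proportional⇒complete : Connected G → (P : Matrix n) → P ⊗ L ≐ L →
    (∀ i j k l → P i j * L k l ≡ P k l * L i j) → IsComplete G
  proportional⇒complete G-connected P PL≐L P∥L = connected∧two-step-closed⇒complete G G-connected closed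
    where
    closed : ∀ {u w v} → adj G u w ≡ true → adj G w v ≡ true → u ≢ v → adj G u v ≡ true
    closed {u} {w} uw = μL²≐L⇒two-step-closed μ μL²≐L uw
      where
      μ : ℚ
      μ = P u w * - 1ℚ
      P≐μL : P ≐ μ · L
      P≐μL = proportional⇒multiple P∥L (cong (_* - 1ℚ) (L-adjacent uw))
      μL²≐L : μ · (L ⊗ L) ≐ L
      μL²≐L = ≐-trans (≐-sym (·-⊗ μ L L)) (≐-trans (⊗-congˡ L (≐-sym P≐μL)) PL≐L)

  δ : Fin n → Fin n → ℚ
  δ i j = if does (i Fin.≟ j) then 1ℚ else 0ℚ

  sum-δ : ∀ i (g : Fin n → ℚ) → sumℚ (λ k → δ i k * g k) ≡ g i
  sum-δ i g = begin
    sumℚ (λ k → δ i k * g k)                          ≡⟨ sum-cong δ*g ⟩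
    sumℚ (λ k → if does (i Fin.≟ k) then g k else 0ℚ) ≡⟨ sum-override i g (λ _ → 0ℚ) refl ⟩
    g i + sumℚ {n} (λ _ → 0ℚ)                         ≡⟨ cong (g i +_) (sum-zero {n} λ _ → refl) ⟩
    g i + 0ℚ                                          ≡⟨ ℚ.+-identityʳ (g i) ⟩
    g i                                               ∎
    where
    δ*g : ∀ k → δ i k * g k ≡ (if does (i Fin.≟ k) then g k else 0ℚ)
    δ*g k with does (i Fin.≟ k)
    ... | true  = ℚ.*-identityˡ (g k)
    ... | false = ℚ.*-zeroˡ (g k)

  L-zeroColumnSums : ∀ j → sumℚ (λ i → L i j) ≡ 0ℚ
  L-zeroColumnSums j = trans (sum-cong λ i → at L-sym j i) (L-zeroRowSums j)

  module _ (G-complete : IsComplete G) where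
    private
      ν : ℚ
      ν = toℚ n

    complete⇒1+deg≡n : ∀ i → 1ℚ + toℚ (deg G i) ≡ ν
    complete⇒1+deg≡n i = begin
      1ℚ + toℚ (deg G i)
        ≡⟨ cong (1ℚ +_) (toℚ-sum (b2ℕ ∘ adj G i)) ⟩
      1ℚ + sumℚ (toℚ ∘ b2ℕ ∘ adj G i)
        ≡⟨ sum-override i (λ _ → 1ℚ) (toℚ ∘ b2ℕ ∘ adj G i) (cong (toℚ ∘ b2ℕ) (adj-irrefl G i)) ⟨
      sumℚ (λ j → if does (i Fin.≟ j) then 1ℚ else toℚ (b2ℕ (adj G i j)))
        ≡⟨ sum-cong (λ j → by-cases j (i Fin.≟ j)) ⟩
      sumℚ {n} (λ _ → 1ℚ)
        ≡⟨ trans (sum-const {n} 1ℚ) (ℚ.*-identityʳ ν) ⟩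
      ν ∎
      where
      by-cases : ∀ j (i≟j : Dec (i ≡ j)) → (if does i≟j then 1ℚ else toℚ (b2ℕ (adj G i j))) ≡ 1ℚ
      by-cases j (yes _)  = refl
      by-cases j (no i≢j) = cong (toℚ ∘ b2ℕ) (G-complete i j i≢j)

    complete⇒L≡νδ-1 : ∀ i j → L i j ≡ ν * δ i j - 1ℚ
    complete⇒L≡νδ-1 i j = by-cases (i Fin.≟ j)
      where
      by-cases : (i≟j : Dec (i ≡ j)) →
        (if does i≟j then toℚ (deg G i) else offDiagonal (adj G i j)) ≡
        ν * (if does i≟j then 1ℚ else 0ℚ) - 1ℚ
      by-cases (yes _)  = trans (x≡1+x-1 (toℚ (deg G i)))
        (cong (_- 1ℚ) (trans (complete⇒1+deg≡n i) (sym (ℚ.*-identityʳ ν))))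
        where
        x≡1+x-1 : ∀ x → x ≡ 1ℚ + x - 1ℚ
        x≡1+x-1 = solve-∀ ℚ-ring
      by-cases (no i≢j) = trans (cong offDiagonal (G-complete i j i≢j)) (-1≡ν*0-1 ν)
        where
        -1≡ν*0-1 : ∀ ν → - 1ℚ ≡ ν * 0ℚ - 1ℚ
        -1≡ν*0-1 = solve-∀ ℚ-ring

    complete⇒L²≐νL : L ⊗ L ≐ ν · L
    complete⇒L²≐νL = mk≐ λ i j → begin
      sumℚ (λ k → L i k * L k j)
        ≡⟨ sum-cong (λ k → trans (cong (_* L k j) (complete⇒L≡νδ-1 i k))
                                 ([νd-1]l≡ν[dl]-l ν (δ i k) (L k j))) ⟩
      sumℚ (λ k → ν * (δ i k * L k j) - L k j)
        ≡⟨ sum-distrib-+ (λ k → ν * (δ i k * L k j)) (λ k → - L k j) ⟩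
      sumℚ (λ k → ν * (δ i k * L k j)) + sumℚ (λ k → - L k j)
        ≡⟨ cong₂ _+_ (sym (*-distribˡ-sum ν (λ k → δ i k * L k j))) (sum-neg (λ k → L k j)) ⟩
      ν * sumℚ (λ k → δ i k * L k j) - sumℚ (λ k → L k j)
        ≡⟨ cong₂ (λ x y → ν * x - y) (sum-δ i (λ k → L k j)) (L-zeroColumnSums j) ⟩
      ν * L i j - 0ℚ
        ≡⟨ x-0≡x (ν * L i j) ⟩
      ν * L i j ∎
      where
      [νd-1]l≡ν[dl]-l : ∀ ν d l → (ν * d - 1ℚ) * l ≡ ν * (d * l) - l
      [νd-1]l≡ν[dl]-l = solve-∀ ℚ-ring
      x-0≡x : ∀ x → x - 0ℚ ≡ x
      x-0≡x = solve-∀ ℚ-ring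

toℚ-16nm⁴ : ∀ n m → toℚ (16 ℕ.* n ℕ.* m ℕ.^ 4) ≡
  toℚ n * ((toℚ (2 ℕ.* m) * toℚ (2 ℕ.* m)) * (toℚ (2 ℕ.* m) * toℚ (2 ℕ.* m)))
toℚ-16nm⁴ n m = begin
  toℚ (16 ℕ.* n ℕ.* m ℕ.^ 4)                      ≡⟨ cong toℚ (16nm⁴≡n[2m]⁴ n m) ⟩
  toℚ (n ℕ.* 2m²²)                                ≡⟨ toℚ-* n 2m²² ⟨
  toℚ n * toℚ 2m²²                                ≡⟨ cong (toℚ n *_) (toℚ-* (2m ℕ.* 2m) (2m ℕ.* 2m)) ⟨
  toℚ n * (toℚ (2m ℕ.* 2m) * toℚ (2m ℕ.* 2m))     ≡⟨ cong (λ z → toℚ n * (z * z)) (toℚ-* 2m 2m) ⟨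
  toℚ n * ((toℚ 2m * toℚ 2m) * (toℚ 2m * toℚ 2m)) ∎
  where
  open ≡-Reasoning
  2m 2m²² : ℕ
  2m = 2 ℕ.* m
  2m²² = (2m ℕ.* 2m) ℕ.* (2m ℕ.* 2m)
  16nm⁴≡n[2m]⁴ : ∀ n m → 16 ℕ.* n ℕ.* (m ℕ.* (m ℕ.* (m ℕ.* (m ℕ.* 1)))) ≡
                         n ℕ.* ((2 ℕ.* m ℕ.* (2 ℕ.* m)) ℕ.* (2 ℕ.* m ℕ.* (2 ℕ.* m)))
  16nm⁴≡n[2m]⁴ = ℕ-Solver.solve-∀

toℚ-^3 : ∀ c → toℚ (c ℕ.^ 3) ≡ toℚ c * (toℚ c * toℚ c)
toℚ-^3 c = trans (cong toℚ (c³≡c[cc] c)) (sym (trans (cong (toℚ c *_) (toℚ-* c c)) (toℚ-* c (c ℕ.* c))))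
  where
  c³≡c[cc] : ∀ c → c ℕ.* (c ℕ.* (c ℕ.* 1)) ≡ c ℕ.* (c ℕ.* c)
  c³≡c[cc] = ℕ-Solver.solve-∀

module LaplacianPseudoInverse {n : ℕ} (G : Graph n) {X : Matrix n}
                              (pinv : IsPseudoInverse (laplacian G) X) where
  open Laplacian G public
  open SymmetricPseudoInverse L-sym pinv public

  private
    ν a b c : ℚ
    ν = toℚ n
    a = inner X X
    b = tr L
    c = inner L L

  16nm⁴≡n*tr⁴ : toℚ (16 ℕ.* n ℕ.* edges G ℕ.^ 4) ≡ ν * ((b * b) * (b * b))
  16nm⁴≡n*tr⁴ = trans (toℚ-16nm⁴ n (edges G)) (cong (λ z → ν * ((z * z) * (z * z))) (sym tr-L))

  BH*[2m+M₁]³≡n*inner*inner³ :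
    BH X * toℚ ((2 ℕ.* edges G ℕ.+ M₁ G) ℕ.^ 3) ≡ ν * ((a * c) * (c * c))
  BH*[2m+M₁]³≡n*inner*inner³ = trans
    (cong₂ _*_ (BH≡n*inner X-sym (zeroRowSums-pinv L-zeroRowSums))
               (trans (toℚ-^3 (2 ℕ.* edges G ℕ.+ M₁ G)) (cong (λ z → z * (z * z)) (sym inner-L-L))))
    (regroup ν a c)
    where
    regroup : ∀ ν a c → (ν * a) * (c * (c * c)) ≡ ν * ((a * c) * (c * c))
    regroup = solve-∀ ℚ-ring

corollary3p1 : ∀ (n : ℕ) → .{{_ : NonZero n}} → (G : Graph n) → Connected G →
    (X : Matrix n) → IsPseudoInverse (laplacian G) X →
    (toℚ (16 Data.Nat.* n Data.Nat.* edges G Data.Nat.^ 4)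
       ≤ BH X * toℚ ((2 Data.Nat.* edges G Data.Nat.+ M₁ G) Data.Nat.^ 3))
    × ((BH X * toℚ ((2 Data.Nat.* edges G Data.Nat.+ M₁ G) Data.Nat.^ 3)
          ≡ toℚ (16 Data.Nat.* n Data.Nat.* edges G Data.Nat.^ 4))
       ⇔ (G ≅ K n))
corollary3p1 n G G-connected X pinv = bound , mk⇔ tight⇒≅K ≅K⇒tight
  where
  open LaplacianPseudoInverse G pinv
  bound : toℚ (16 ℕ.* n ℕ.* edges G ℕ.^ 4) ≤ BH X * toℚ ((2 ℕ.* edges G ℕ.+ M₁ G) ℕ.^ 3)
  bound = subst₂ _≤_ (sym 16nm⁴≡n*tr⁴) (sym BH*[2m+M₁]³≡n*inner*inner³)
    (ℚ.*-monoˡ-≤-nonNeg (toℚ n) {{ℚ.nonNegative (toℚ-nonNeg n)}} trace⁴-bound)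
  tight⇒≅K : BH X * toℚ ((2 ℕ.* edges G ℕ.+ M₁ G) ℕ.^ 3) ≡ toℚ (16 ℕ.* n ℕ.* edges G ℕ.^ 4) →
             G ≅ K n
  tight⇒≅K tight = complete⇒≅K G (proportional⇒complete G-connected P PA≐A
    (trace⁴-bound-tight⇒proportional (*-cancelˡ-≡ (toℚ n) (toℚ-nonZero n)
      (trans (sym 16nm⁴≡n*tr⁴) (trans (sym tight) BH*[2m+M₁]³≡n*inner*inner³)))))
  ≅K⇒tight : G ≅ K n →
             BH X * toℚ ((2 ℕ.* edges G ℕ.+ M₁ G) ℕ.^ 3) ≡ toℚ (16 ℕ.* n ℕ.* edges G ℕ.^ 4)
  ≅K⇒tight G≅K = trans BH*[2m+M₁]³≡n*inner*inner³ (trans (cong (toℚ n *_) (sym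
    (trace⁴-bound-tight (toℚ n) (toℚ-nonZero n) (complete⇒L²≐νL (≅K⇒complete G G≅K)))))
    (sym 16nm⁴≡n*tr⁴))
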